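{- Let $s=\psi(y)$, $y=y_1y_2\cdots$ with $y_1=a$, be a characteristic Sturmian word beginning with the letter $a$. Then $s$ has the property that for every $n\geq1$ its palindromic prefix of order $n$ has the maximal number of occurrences of $b$ among the palindromic prefixes of order $n$ of characteristic Sturmian words beginning with $a$ (i.e. $|\psi(y_1\cdots y_n)|_b\geq|\psi(v)|_b$ for every word $v$ of length $n$ beginning with $a$) if and only if $s=f=\psi((ab)^\omega)$ or $s=g=\psi(ab^2(ab)^\omega)$.
   Context: Let $\mathcal{A}=\{a,b\}$; $|w|_b$ counts occurrences of $b$ in $w$. $w^{(+)}$ is the shortest palindrome having $w$ as a prefix; $\psi(\varepsilon)=\varepsilon$, $\psi(vx)=(\psi(v)x)^{(+)}$. $\psi$ extends to infinite words by $\psi(y)=\lim_n\psi(y_1\cdots y_n)$ ($y$ is the directive word). Characteristic Sturmian words are exactly the words $\psi(y)$ with both letters occurring infinitely often in $y$; $\psi(y)$ begins with $a$ iff $y_1=a$. The palindromic prefix of order $n$ of $\psi(y)$ is $\psi(y_1\cdots y_n)$. -}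

module Defs where

open import Data.Nat using (ℕ; zero; suc; _≤_)
open import Data.List using (List; []; _∷_; _++_; reverse; take; length; foldl; applyUpTo; [_])
open import Data.List.Properties using (≡-dec)
open import Data.Product using (∃; _×_)
open import Data.Bool using (if_then_else_)
open import Relation.Nullary using (Dec; yes; no; does)
open import Relation.Binary.PropositionalEquality using (_≡_; refl)

data Letter : Set where
  a b : Letter

_≟L_ : (x y : Letter) → Dec (x ≡ y)
a ≟L a = yes refl
a ≟L b = no (λ ())
b ≟L a = no (λ ())
b ≟L b = yes refl

Word : Set
Word = List Letter

_≟W_ : (u v : Word) → Dec (u ≡ v)
_≟W_ = ≡-dec _≟L_

countB : Word → ℕ
countB [] = 0
countB (a ∷ w) = countB w
countB (b ∷ w) = suc (countB w)

-- A palindrome of length |w| + k having w as a prefix is necessarily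
-- w ++ reverse (take k w); so w^(+) is the first such candidate (k = 0, 1, …)
-- which is a palindrome.  k = |w| always works.
candidate : Word → ℕ → Word
candidate w k = w ++ reverse (take k w)

searchPal : ℕ → ℕ → Word → Word
searchPal zero    k w = candidate w k
searchPal (suc r) k w =
  if does (reverse (candidate w k) ≟W candidate w k)
  then candidate w k
  else searchPal r (suc k) w

-- w^(+) : shortest palindrome having w as prefix
palClosure : Word → Word
palClosure w = searchPal (length w) 0 w

ψ : Word → Word
ψ = foldl (λ u x → palClosure (u ++ [ x ])) []

-- infinite (directive) words, 0-indexed: y 0 = y₁
InfWord : Set
InfWord = ℕ → Letter

prefix : ℕ → InfWord → Word
prefix n y = applyUpTo y n

-- i-th letter of a finite word (default a when out of range; never used
-- out of range below since |ψ(w)| ≥ |w|)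
nth : Word → ℕ → Letter
nth []      _       = a
nth (x ∷ _) zero    = x
nth (_ ∷ w) (suc i) = nth w i

-- ψ(y) = lim ψ(y₁⋯yₙ) : its letter at position i is the letter at position i
-- of ψ(y₁⋯y_{i+1}) (all later palindromic prefixes extend it).
ψ∞ : InfWord → InfWord
ψ∞ y i = nth (ψ (prefix (suc i) y)) i

BothInfinitelyOften : InfWord → Set
BothInfinitelyOften y =
  (∀ n → ∃ λ m → n ≤ m × y m ≡ a) × (∀ n → ∃ λ m → n ≤ m × y m ≡ b)

fDir : InfWord
fDir zero = a
fDir (suc zero) = b
fDir (suc (suc i)) = fDir i

gDir : InfWord
gDir zero = a
gDir (suc zero) = b
gDir (suc (suc zero)) = b
gDir (suc (suc (suc i))) = fDir i

f g : InfWord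
f = ψ∞ fDir
g = ψ∞ gDir

module Submission where

-- We run a state (u, R_a, R_b), starting from
--     (ε, a, b), with u ↦ u R_x, R_x ↦ R_x, R_y ↦ R_y R_x on reading x ≠ y.
--     An invariant ('Coherent') shows (u x)^(+) = u R_x, so u = ψ(v) after
--     reading v.  It rests on the characterisation of w^(+) as w t with t
--     shortest such that w t is a palindrome.
-- (2) Counting.  The b-counts (|u|_b, |R_a|_b, |R_b|_b) then evolve by a
--     linear rule, so |ψ(v)|_b is an explicit function 'total' of v.  For
--     v = a u it is bounded by 'peak |u| 1 0'; (ab)^ω attains the bound at
--     every length, and the only directive words attaining it at every
--     length are (ab)^ω and ab²(ab)^ω.
-- (3) Limits.  ψ∞ y determines y (ψ∞ y reads y_k at position |ψ(y₁⋯y_{k-1})|),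
--     so ψ∞ y = f or g exactly when y = (ab)^ω or ab²(ab)^ω.

open import Defs
open import Data.Nat using (ℕ; _≤_)
open import Data.List using (List; _∷_; length)
open import Data.Sum using (_⊎_)
open import Data.Product using (∃)
open import Function.Bundles using (_⇔_)
open import Relation.Binary.PropositionalEquality using (_≡_; _≗_)

open import Data.Nat using (zero; suc; _+_; _<_; z≤n; s≤s)
open import Data.Nat.Properties
open import Data.List using ([]; _++_; reverse; take; foldl; applyUpTo; [_])
open import Data.List.Properties
  using (++-assoc; ++-cancelˡ; ++-identityʳ; length-++; length-++-≤ˡ; reverse-++;
         reverse-involutive; length-reverse; length-take; ∷-injective; ∷-injectiveˡ; ∷-injectiveʳ;
         foldl-++; applyUpTo-∷ʳ; length-applyUpTo)
open import Data.Product using (_×_; _,_; proj₁; proj₂)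
open import Data.Sum using (inj₁; inj₂)
import Data.Sum as Sum
open import Function using (_∘_)
open import Data.Empty using (⊥-elim)
open import Function.Bundles using (mk⇔)
open import Relation.Nullary using (¬_; yes; no)
open import Relation.Binary.PropositionalEquality
  using (refl; sym; trans; cong; cong₂; subst; subst₂; module ≡-Reasoning)

Palindrome : {X : Set} → List X → Set
Palindrome w = reverse w ≡ w

module _ {X : Set} where

  ++-equidivisible : ∀ (p q r s : List X) → p ++ q ≡ r ++ s →
    (∃ λ m → r ≡ p ++ m × q ≡ m ++ s) ⊎ (∃ λ m → p ≡ r ++ m × s ≡ m ++ q)
  ++-equidivisible []      q r       s eq = inj₁ (r , refl , eq)
  ++-equidivisible (x ∷ p) q []      s eq = inj₂ (x ∷ p , refl , sym eq)
  ++-equidivisible (x ∷ p) q (y ∷ r) s eq with ∷-injective eq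
  ... | refl , eq′ with ++-equidivisible p q r s eq′
  ...   | inj₁ (m , e₁ , e₂) = inj₁ (m , cong (x ∷_) e₁ , e₂)
  ...   | inj₂ (m , e₁ , e₂) = inj₂ (m , cong (x ∷_) e₁ , e₂)

  take-length-++ : ∀ (xs ys : List X) → take (length xs) (xs ++ ys) ≡ xs
  take-length-++ []       ys = refl
  take-length-++ (x ∷ xs) ys = cong (x ∷_) (take-length-++ xs ys)

  length-++-∷ : ∀ (p : List X) x s → length (p ++ x ∷ s) ≡ length p + suc (length s)
  length-++-∷ p x s = length-++ p

  reverse-++-∷ : ∀ (p : List X) x s → reverse (p ++ x ∷ s) ≡ reverse s ++ x ∷ reverse p
  reverse-++-∷ p x s = begin
    reverse (p ++ x ∷ s)         ≡⟨ reverse-++ p (x ∷ s) ⟩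
    reverse (x ∷ s) ++ reverse p ≡⟨ cong (_++ reverse p) (reverse-++ [ x ] s) ⟩
    (reverse s ++ [ x ]) ++ reverse p ≡⟨ ++-assoc (reverse s) [ x ] (reverse p) ⟩
    reverse s ++ x ∷ reverse p   ∎
    where open ≡-Reasoning

  mirror-prefix : ∀ (t m : List X) → t ≡ reverse (take (length t) (reverse t ++ m))
  mirror-prefix t m = begin
    t                                                    ≡⟨ sym (reverse-involutive t) ⟩
    reverse (reverse t)                                  ≡⟨ cong reverse (sym (take-length-++ (reverse t) m)) ⟩
    reverse (take (length (reverse t)) (reverse t ++ m))
      ≡⟨ cong (λ n → reverse (take n (reverse t ++ m))) (length-reverse t) ⟩
    reverse (take (length t) (reverse t ++ m))           ∎
    where open ≡-Reasoning

  palindrome-tail : ∀ (w t : List X) → Palindrome (w ++ t) → length t ≤ length w →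
    t ≡ reverse (take (length t) w)
  palindrome-tail w t pal t≤w
    with ++-equidivisible (reverse t) (reverse w) w t (trans (sym (reverse-++ w t)) pal)
  ... | inj₁ (m , w≡ , _) =
    trans (mirror-prefix t m) (cong (λ v → reverse (take (length t) v)) (sym w≡))
  ... | inj₂ ([] , rt≡ , _) =
    trans (mirror-prefix t [])
      (cong (λ v → reverse (take (length t) v)) (trans (++-identityʳ (reverse t)) (trans rt≡ (++-identityʳ w))))
  ... | inj₂ (x ∷ m , rt≡ , _) = ⊥-elim (m+1+n≰m (length w) (begin
    length w + suc (length m) ≡⟨ sym (length-++-∷ w x m) ⟩
    length (w ++ x ∷ m)       ≡⟨ cong length (sym rt≡) ⟩
    length (reverse t)        ≡⟨ length-reverse t ⟩
    length t                  ≤⟨ t≤w ⟩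
    length w                  ∎))
    where open ≤-Reasoning

  -- Written as commutations, "U P and U Q are palindromes" (for U a palindrome)
  -- implies that (U P)(Q P) is a palindrome as well.
  mirror-extend : ∀ (U P Q : List X) → reverse P ++ U ≡ U ++ P → reverse Q ++ U ≡ U ++ Q →
    reverse (Q ++ P) ++ (U ++ P) ≡ (U ++ P) ++ (Q ++ P)
  mirror-extend U P Q mirrorP mirrorQ = begin
    reverse (Q ++ P) ++ (U ++ P)            ≡⟨ cong (_++ (U ++ P)) (reverse-++ Q P) ⟩
    (reverse P ++ reverse Q) ++ (U ++ P)    ≡⟨ ++-assoc (reverse P) (reverse Q) (U ++ P) ⟩
    reverse P ++ (reverse Q ++ (U ++ P))    ≡⟨ cong (reverse P ++_) (sym (++-assoc (reverse Q) U P)) ⟩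
    reverse P ++ ((reverse Q ++ U) ++ P)    ≡⟨ cong (λ v → reverse P ++ (v ++ P)) mirrorQ ⟩
    reverse P ++ ((U ++ Q) ++ P)            ≡⟨ cong (reverse P ++_) (++-assoc U Q P) ⟩
    reverse P ++ (U ++ (Q ++ P))            ≡⟨ sym (++-assoc (reverse P) U (Q ++ P)) ⟩
    (reverse P ++ U) ++ (Q ++ P)            ≡⟨ cong (_++ (Q ++ P)) mirrorP ⟩
    (U ++ P) ++ (Q ++ P)                    ∎
    where open ≡-Reasoning

searchPal-first : ∀ r k w c → Palindrome (candidate w c) → k ≤ c → c ≤ k + r →
  (∀ i → k ≤ i → i < c → ¬ Palindrome (candidate w i)) → searchPal r k w ≡ candidate w c
searchPal-first zero k w c _ k≤c c≤k+0 _ =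
  cong (candidate w) (≤-antisym k≤c (subst (c ≤_) (+-identityʳ k) c≤k+0))
searchPal-first (suc r) k w c pal k≤c c≤k+r earlier with reverse (candidate w k) ≟W candidate w k
... | yes palk with m≤n⇒m<n∨m≡n k≤c
...   | inj₁ k<c = ⊥-elim (earlier k ≤-refl k<c palk)
...   | inj₂ k≡c = cong (candidate w) k≡c
searchPal-first (suc r) k w c pal k≤c c≤k+r earlier | no ¬palk =
  searchPal-first r (suc k) w c pal k<c (subst (c ≤_) (+-suc k r) c≤k+r)
    (λ i k<i i<c → earlier i (≤-trans (n≤1+n k) k<i) i<c)
  where
  k<c : k < c
  k<c = ≤∧≢⇒< k≤c (λ k≡c → ¬palk (subst (λ i → Palindrome (candidate w i)) (sym k≡c) pal))

palClosure-shortest : ∀ w t → Palindrome (w ++ t) →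
  (∀ t′ → Palindrome (w ++ t′) → length t ≤ length t′) → palClosure w ≡ w ++ t
palClosure-shortest w t pal shortest =
  trans (searchPal-first (length w) 0 w (length t) (subst Palindrome wt≡ pal) z≤n t≤w earlier)
        (sym wt≡)
  where
  w-mirrored : Palindrome (w ++ reverse w)
  w-mirrored = trans (reverse-++ w (reverse w)) (cong (_++ reverse w) (reverse-involutive w))
  t≤w : length t ≤ length w
  t≤w = subst (length t ≤_) (length-reverse w) (shortest (reverse w) w-mirrored)
  wt≡ : w ++ t ≡ candidate w (length t)
  wt≡ = cong (w ++_) (palindrome-tail w t pal t≤w)
  candidate-length : ∀ i → length (reverse (take i w)) ≤ i
  candidate-length i = subst (_≤ i) (sym (trans (length-reverse (take i w)) (length-take i w)))
                             (m⊓n≤m i (length w))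
  earlier : ∀ i → 0 ≤ i → i < length t → ¬ Palindrome (candidate w i)
  earlier i _ i<t pali = <⇒≱ i<t (≤-trans (shortest _ pali) (candidate-length i))

-- The state of Justin's recursion: pal is ψ(v) for the word v read so far,
-- and ext x is the word R_x with ψ(v x) = ψ(v) R_x.
record State : Set where
  constructor state
  field
    pal extA extB : Word
open State

ext : Letter → State → Word
ext a = extA
ext b = extB

advance : State → Letter → State
advance (state p eA eB) a = state (p ++ eA) eA (eB ++ eA)
advance (state p eA eB) b = state (p ++ eB) (eA ++ eB) eB

pal-advance : ∀ s x → pal (advance s x) ≡ pal s ++ ext x s
pal-advance (state _ _ _) a = refl
pal-advance (state _ _ _) b = refl

length-pal-advance : ∀ s x → length (pal (advance s x)) ≡ length (pal s) + length (ext x s)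
length-pal-advance s x = trans (cong length (pal-advance s x)) (length-++ (pal s))

ext-advance-same : ∀ s x → ext x (advance s x) ≡ ext x s
ext-advance-same (state _ _ _) a = refl
ext-advance-same (state _ _ _) b = refl

ext-advance : ∀ s x y →
  (y ≡ x × ext y (advance s x) ≡ ext x s) ⊎ ext y (advance s x) ≡ ext y s ++ ext x s
ext-advance (state _ _ _) a a = inj₁ (refl , refl)
ext-advance (state _ _ _) a b = inj₂ refl
ext-advance (state _ _ _) b a = inj₂ refl
ext-advance (state _ _ _) b b = inj₁ (refl , refl)

length-ext-advance : ∀ s x y → length (ext y (advance s x)) ≤ length (ext y s) + length (ext x s)
length-ext-advance s x y with ext-advance s x y
... | inj₁ (refl , e) = subst (_≤ length (ext x s) + length (ext x s)) (sym (cong length e)) (m≤n+m _ _)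
... | inj₂ e = ≤-reflexive (trans (cong length e) (length-++ (ext y s)))

record Coherent (s : State) : Set where
  field
    palindromic : Palindrome (pal s)
    mirrored    : ∀ x → reverse (ext x s) ++ pal s ≡ pal s ++ ext x s
    headed      : ∀ x → ∃ λ r → ext x s ≡ x ∷ r
    bounded     : ∀ x → length (ext x s) ≤ suc (length (pal s))
    minimal     : ∀ q x t → Palindrome q → q ++ x ∷ t ≡ pal s →
                  length q + length (ext x s) ≤ length (pal s)
open Coherent

ext-completes : ∀ {s} → Coherent s → ∀ x → Palindrome (pal s ++ ext x s)
ext-completes {s} C x =
  trans (reverse-++ (pal s) (ext x s)) (trans (cong (reverse (ext x s) ++_) (palindromic C)) (mirrored C x))

ext-shortest : ∀ {s} → Coherent s → ∀ x t → Palindrome (pal s ++ x ∷ t) →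
  length (ext x s) ≤ suc (length t)
ext-shortest {s} C x t uxt-pal = by-cases (++-equidivisible U (x ∷ t) (reverse t) (x ∷ U) two-readings)
  where
  U = pal s
  two-readings : U ++ x ∷ t ≡ reverse t ++ x ∷ U
  two-readings = trans (sym uxt-pal)
    (trans (reverse-++-∷ U x t) (cong (λ v → reverse t ++ x ∷ v) (palindromic C)))
  long-tail : length U ≤ length t → length (ext x s) ≤ suc (length t)
  long-tail U≤t = ≤-trans (bounded C x) (s≤s U≤t)
  by-cases : (∃ λ m → reverse t ≡ U ++ m × x ∷ t ≡ m ++ x ∷ U) ⊎
             (∃ λ m → U ≡ reverse t ++ m × x ∷ U ≡ m ++ x ∷ t) → length (ext x s) ≤ suc (length t)
  by-cases (inj₁ (m , rt≡ , _)) = long-tail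
    (subst (length U ≤_) (trans (cong length (sym rt≡)) (length-reverse t)) (length-++-≤ˡ U))
  by-cases (inj₂ ([] , U≡ , _)) = long-tail
    (≤-reflexive (trans (cong length (trans U≡ (++-identityʳ _))) (length-reverse t)))
  by-cases (inj₂ (y ∷ m , U≡ , xU≡)) with ∷-injective xU≡
  ... | refl , U≡′ = +-cancelˡ-≤ (length m) _ _
    (subst (length m + length (ext x s) ≤_) (trans (cong length U≡′) (length-++-∷ m x t))
      (minimal C m x t m-pal (sym U≡′)))
    where
    m-pal : Palindrome m
    m-pal = ∷-injectiveʳ (++-cancelˡ (reverse t) _ _ (begin
      reverse t ++ x ∷ reverse m ≡⟨ sym (reverse-++-∷ m x t) ⟩
      reverse (m ++ x ∷ t)       ≡⟨ cong reverse (sym U≡′) ⟩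
      reverse U                  ≡⟨ palindromic C ⟩
      U                          ≡⟨ U≡ ⟩
      reverse t ++ x ∷ m         ∎))
      where open ≡-Reasoning

palClosure-advance : ∀ {s} → Coherent s → ∀ x → palClosure (pal s ++ [ x ]) ≡ pal (advance s x)
palClosure-advance {s} C x with headed C x
... | r , ext≡ = begin
  palClosure (pal s ++ [ x ]) ≡⟨ palClosure-shortest (pal s ++ [ x ]) r closes shortest ⟩
  (pal s ++ [ x ]) ++ r       ≡⟨ ++-assoc (pal s) [ x ] r ⟩
  pal s ++ x ∷ r              ≡⟨ cong (pal s ++_) (sym ext≡) ⟩
  pal s ++ ext x s            ≡⟨ sym (pal-advance s x) ⟩
  pal (advance s x)           ∎
  where
  open ≡-Reasoning
  closes : Palindrome ((pal s ++ [ x ]) ++ r)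
  closes = subst Palindrome (trans (cong (pal s ++_) ext≡) (sym (++-assoc (pal s) [ x ] r)))
                 (ext-completes C x)
  shortest : ∀ t′ → Palindrome ((pal s ++ [ x ]) ++ t′) → length r ≤ length t′
  shortest t′ p = ≤-pred (subst (_≤ suc (length t′)) (cong length ext≡)
    (ext-shortest C x t′ (subst Palindrome (++-assoc (pal s) [ x ] t′) p)))

mirrored-advance : ∀ {s} → Coherent s → ∀ x y →
  reverse (ext y (advance s x)) ++ pal (advance s x) ≡ pal (advance s x) ++ ext y (advance s x)
mirrored-advance {s} C x y rewrite pal-advance s x with ext-advance s x y
... | inj₁ (_ , e) rewrite e =
  mirror-extend (pal s) (ext x s) [] (mirrored C x) (sym (++-identityʳ (pal s)))
... | inj₂ e rewrite e = mirror-extend (pal s) (ext x s) (ext y s) (mirrored C x) (mirrored C y)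

headed-advance : ∀ {s} → Coherent s → ∀ x y → ∃ λ r → ext y (advance s x) ≡ y ∷ r
headed-advance {s} C x y with ext-advance s x y
... | inj₁ (refl , e) = proj₁ (headed C x) , trans e (proj₂ (headed C x))
... | inj₂ e = proj₁ (headed C y) ++ ext x s , trans e (cong (_++ ext x s) (proj₂ (headed C y)))

bounded-advance : ∀ {s} → Coherent s → ∀ x y →
  length (ext y (advance s x)) ≤ suc (length (pal (advance s x)))
bounded-advance {s} C x y = begin
  length (ext y (advance s x))            ≤⟨ length-ext-advance s x y ⟩
  length (ext y s) + length (ext x s)     ≤⟨ +-monoˡ-≤ (length (ext x s)) (bounded C y) ⟩
  suc (length (pal s) + length (ext x s)) ≡⟨ cong suc (sym (length-pal-advance s x)) ⟩
  suc (length (pal (advance s x)))        ∎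
  where open ≤-Reasoning

-- A palindromic prefix q of the new u followed by y either lies in the old u
-- (old minimality), equals the old u (then y = x), or strictly extends u
-- inside R_x (impossible by 'ext-shortest').
minimal-advance : ∀ {s} → Coherent s → ∀ x q y t → Palindrome q → q ++ y ∷ t ≡ pal (advance s x) →
  length q + length (ext y (advance s x)) ≤ length (pal (advance s x))
minimal-advance {s} C x q y t q-pal q-prefix =
  by-cases (++-equidivisible q (y ∷ t) U Rx (trans q-prefix (pal-advance s x)))
  where
  U = pal s
  Rx = ext x s
  s′ = advance s x
  Goal = length q + length (ext y s′) ≤ length (pal s′)
  at-end : q ≡ U → y ∷ t ≡ Rx → Goal
  at-end q≡ yt≡ = ≤-reflexive (trans (cong₂ (λ p r → length p + length r) q≡ ext-y≡)
                                     (sym (length-pal-advance s x)))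
    where
    ext-y≡ : ext y s′ ≡ Rx
    ext-y≡ = subst (λ z → ext z s′ ≡ Rx) (sym (∷-injectiveˡ (trans yt≡ (proj₂ (headed C x)))))
                   (ext-advance-same s x)
  inside : ∀ m → U ≡ q ++ y ∷ m → Goal
  inside m U≡ = begin
    length q + length (ext y s′)                ≤⟨ +-monoʳ-≤ (length q) (length-ext-advance s x y) ⟩
    length q + (length (ext y s) + length Rx)   ≡⟨ sym (+-assoc (length q) _ _) ⟩
    length q + length (ext y s) + length Rx     ≤⟨ +-monoˡ-≤ (length Rx) (minimal C q y m q-pal (sym U≡)) ⟩
    length U + length Rx                        ≡⟨ sym (length-pal-advance s x) ⟩
    length (pal s′)                             ∎
    where open ≤-Reasoning
  beyond : ∀ m → q ≡ U ++ x ∷ m → Rx ≡ x ∷ m ++ y ∷ t → Goal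
  beyond m q≡ Rx≡ = ⊥-elim (m+1+n≰m (length m) (≤-pred
    (subst (_≤ suc (length m)) (trans (cong length Rx≡) (cong suc (length-++-∷ m y t)))
      (ext-shortest C x m (subst Palindrome q≡ q-pal)))))
  by-cases : (∃ λ m → U ≡ q ++ m × y ∷ t ≡ m ++ Rx) ⊎
             (∃ λ m → q ≡ U ++ m × Rx ≡ m ++ y ∷ t) → Goal
  by-cases (inj₁ ([] , U≡ , yt≡)) = at-end (sym (trans U≡ (++-identityʳ q))) yt≡
  by-cases (inj₁ (_ ∷ m , U≡ , yt≡)) with ∷-injective yt≡
  ... | refl , _ = inside m U≡
  by-cases (inj₂ ([] , q≡ , Rx≡)) = at-end (trans q≡ (++-identityʳ U)) (sym Rx≡)
  by-cases (inj₂ (_ ∷ m , q≡ , Rx≡)) with ∷-injective (trans (sym Rx≡) (proj₂ (headed C x)))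
  ... | refl , _ = beyond m q≡ Rx≡

advance-coherent : ∀ {s} → Coherent s → ∀ x → Coherent (advance s x)
advance-coherent {s} C x = record
  { palindromic = subst Palindrome (sym (pal-advance s x)) (ext-completes C x)
  ; mirrored    = mirrored-advance C x
  ; headed      = headed-advance C x
  ; bounded     = bounded-advance C x
  ; minimal     = minimal-advance C x
  }

initial : State
initial = state [] [ a ] [ b ]

initial-coherent : Coherent initial
initial-coherent = record
  { palindromic = refl
  ; mirrored    = λ { a → refl ; b → refl }
  ; headed      = λ { a → [] , refl ; b → [] , refl }
  ; bounded     = λ { a → s≤s z≤n ; b → s≤s z≤n }
  ; minimal     = λ { [] _ _ _ () ; (_ ∷ _) _ _ _ () }
  }

runFrom : State → Word → State
runFrom = foldl advance

run : Word → State
run = runFrom initial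

ψ-step : Word → Letter → Word
ψ-step u x = palClosure (u ++ [ x ])

ψ-runFrom : ∀ {s} → Coherent s → ∀ v → foldl ψ-step (pal s) v ≡ pal (runFrom s v)
ψ-runFrom C []      = refl
ψ-runFrom C (x ∷ v) =
  trans (cong (λ u → foldl ψ-step u v) (palClosure-advance C x)) (ψ-runFrom (advance-coherent C x) v)

ψ-run : ∀ v → ψ v ≡ pal (run v)
ψ-run = ψ-runFrom initial-coherent

pal-runFrom-extends : ∀ s v → ∃ λ t → pal (runFrom s v) ≡ pal s ++ t
pal-runFrom-extends s []      = [] , sym (++-identityʳ (pal s))
pal-runFrom-extends s (x ∷ v) with pal-runFrom-extends (advance s x) v
... | t , e = ext x s ++ t , trans e (trans (cong (_++ t) (pal-advance s x)) (++-assoc (pal s) (ext x s) t))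

length-runFrom : ∀ {s} → Coherent s → ∀ v → length (pal s) + length v ≤ length (pal (runFrom s v))
length-runFrom {s} C []      = ≤-reflexive (+-identityʳ (length (pal s)))
length-runFrom {s} C (x ∷ v) = begin
  length (pal s) + suc (length v)       ≡⟨ +-suc (length (pal s)) (length v) ⟩
  suc (length (pal s)) + length v       ≤⟨ +-monoˡ-≤ (length v) one-more ⟩
  length (pal (advance s x)) + length v ≤⟨ length-runFrom (advance-coherent C x) v ⟩
  length (pal (runFrom s (x ∷ v)))      ∎
  where
  open ≤-Reasoning
  one-more : suc (length (pal s)) ≤ length (pal (advance s x))
  one-more with headed C x
  ... | r , e = subst (suc (length (pal s)) ≤_)
    (sym (trans (length-pal-advance s x) (cong (λ w → length (pal s) + length w) e)))
    (m<m+n (length (pal s)) (s≤s z≤n))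


runFrom-coherent : ∀ {s} → Coherent s → ∀ v → Coherent (runFrom s v)
runFrom-coherent C []      = C
runFrom-coherent C (x ∷ v) = runFrom-coherent (advance-coherent C x) v

nth-++-∷ : ∀ w x r → nth (w ++ x ∷ r) (length w) ≡ x
nth-++-∷ []      x r = refl
nth-++-∷ (_ ∷ w) x r = nth-++-∷ w x r

nth-runFrom : ∀ {s} → Coherent s → ∀ x v → nth (pal (runFrom s (x ∷ v))) (length (pal s)) ≡ x
nth-runFrom {s} C x v with headed C x | pal-runFrom-extends (advance s x) v
... | r , ext≡ | t , extends = trans (cong (λ w → nth w (length (pal s))) pal≡) (nth-++-∷ (pal s) x (r ++ t))
  where
  open ≡-Reasoning
  pal≡ : pal (runFrom s (x ∷ v)) ≡ pal s ++ x ∷ (r ++ t)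
  pal≡ = begin
    pal (runFrom (advance s x) v) ≡⟨ extends ⟩
    pal (advance s x) ++ t        ≡⟨ cong (_++ t) (trans (pal-advance s x) (cong (pal s ++_) ext≡)) ⟩
    (pal s ++ x ∷ r) ++ t         ≡⟨ ++-assoc (pal s) (x ∷ r) t ⟩
    pal s ++ x ∷ (r ++ t)         ∎

-- The b-counts (|u|_b, |R_a|_b, |R_b|_b) and their evolution under advance.
Counts : Set
Counts = ℕ × ℕ × ℕ

countStep : Counts → Letter → Counts
countStep (p , α , β) a = (p + α , α , β + α)
countStep (p , α , β) b = (p + β , α + β , β)

total : Counts → Word → ℕ
total c v = proj₁ (foldl countStep c v)

countB-++ : ∀ (u v : Word) → countB (u ++ v) ≡ countB u + countB v
countB-++ []      v = refl
countB-++ (a ∷ u) v = countB-++ u v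
countB-++ (b ∷ u) v = cong suc (countB-++ u v)

counts : State → Counts
counts s = countB (pal s) , countB (extA s) , countB (extB s)

counts-advance : ∀ s x → counts (advance s x) ≡ countStep (counts s) x
counts-advance (state p eA eB) a rewrite countB-++ p eA | countB-++ eB eA = refl
counts-advance (state p eA eB) b rewrite countB-++ p eB | countB-++ eA eB = refl

counts-runFrom : ∀ s v → counts (runFrom s v) ≡ foldl countStep (counts s) v
counts-runFrom s []      = refl
counts-runFrom s (x ∷ v) =
  trans (counts-runFrom (advance s x) v) (cong (λ c → foldl countStep c v) (counts-advance s x))

countB-ψ : ∀ v → countB (ψ v) ≡ total (0 , 0 , 1) v
countB-ψ v = trans (cong countB (ψ-run v)) (cong proj₁ (counts-runFrom initial v))

-- peak m M μ bounds the b's gained in m steps from counts (α, β) with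
-- α, β ≤ M and α + β ≤ M + μ: always take the letter with the larger count.
peak : ℕ → ℕ → ℕ → ℕ
peak zero    M μ = 0
peak (suc m) M μ = M + peak m (μ + M) M

-- The peak bound, by induction on w; the invariant hypotheses on (α, β)
-- propagate to the next step with (M, μ) replaced by (μ + M, M).
total-≤-peak : ∀ w p α β M μ → α ≤ M → β ≤ M → α + β ≤ M + μ →
  total (p , α , β) w ≤ p + peak (length w) M μ
total-≤-peak []      p α β M μ _   _   _    = ≤-reflexive (sym (+-identityʳ p))
total-≤-peak (a ∷ w) p α β M μ α≤M β≤M α+β≤ = begin
  total (p + α , α , β + α) w      ≤⟨ total-≤-peak w (p + α) α (β + α) (μ + M) M
                                        (≤-trans α≤M (m≤n+m M μ))
                                        (subst₂ _≤_ (+-comm α β) (+-comm M μ) α+β≤)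
                                        (subst₂ _≤_ (+-assoc α β α) (cong (_+ M) (+-comm M μ)) (+-mono-≤ α+β≤ α≤M)) ⟩
  p + α + peak (length w) (μ + M) M ≤⟨ ≤-reflexive (+-assoc p α _) ⟩
  p + (α + peak (length w) (μ + M) M) ≤⟨ +-monoʳ-≤ p (+-monoˡ-≤ _ α≤M) ⟩
  p + peak (length (a ∷ w)) M μ    ∎
  where open ≤-Reasoning
total-≤-peak (b ∷ w) p α β M μ α≤M β≤M α+β≤ = begin
  total (p + β , α + β , β) w      ≤⟨ total-≤-peak w (p + β) (α + β) β (μ + M) M
                                        (subst (α + β ≤_) (+-comm M μ) α+β≤)
                                        (≤-trans β≤M (m≤n+m M μ))
                                        (subst (α + β + β ≤_) (cong (_+ M) (+-comm M μ)) (+-mono-≤ α+β≤ β≤M)) ⟩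
  p + β + peak (length w) (μ + M) M ≤⟨ ≤-reflexive (+-assoc p β _) ⟩
  p + (β + peak (length w) (μ + M) M) ≤⟨ +-monoʳ-≤ p (+-monoˡ-≤ _ β≤M) ⟩
  p + peak (length (b ∷ w)) M μ    ∎
  where open ≤-Reasoning

mutual
  total-fDir : ∀ m p α β → β ≤ α → total (p , α , β) (applyUpTo fDir m) ≡ p + peak m α β
  total-fDir zero    p α β _ = sym (+-identityʳ p)
  total-fDir (suc m) p α β _ =
    trans (total-fDir-shift m (p + α) α (β + α) (m≤n+m α β)) (+-assoc p α _)

  total-fDir-shift : ∀ m p α β → α ≤ β →
    total (p , α , β) (applyUpTo (λ i → fDir (suc i)) m) ≡ p + peak m β α
  total-fDir-shift zero    p α β _ = sym (+-identityʳ p)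
  total-fDir-shift (suc m) p α β _ =
    trans (total-fDir m (p + β) (α + β) β (m≤n+m β α)) (+-assoc p β _)

Peaks : InfWord → ℕ → ℕ → ℕ → ℕ → ℕ → Set
Peaks z p α β M μ = ∀ m → p + peak m M μ ≤ total (p , α , β) (applyUpTo z m)

total-cons : ∀ (z : InfWord) x c m → z 0 ≡ x →
  total c (applyUpTo z (suc m)) ≡ total (countStep c x) (applyUpTo (λ i → z (suc i)) m)
total-cons z x c m z0≡x = cong (λ y → total (countStep c y) (applyUpTo (λ i → z (suc i)) m)) z0≡x

-- With distinct positive counts, attaining the peak forces the letter with
-- the larger count at every step, i.e. z is (ab)^ω or (ba)^ω.
mutual
  peaks-forces-fDir : ∀ z p α β → 0 < β → β < α → Peaks z p α β α β → z ≗ fDir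
  peaks-forces-fDir z p α β 0<β β<α peaks i with z 0 in z0≡
  ... | b = ⊥-elim (<⇒≱ (+-monoʳ-< p β<α)
    (subst₂ _≤_ (cong (p +_) (+-identityʳ α)) (total-cons z b _ 0 z0≡) (peaks 1)))
  peaks-forces-fDir z p α β 0<β β<α peaks zero    | a = z0≡
  peaks-forces-fDir z p α β 0<β β<α peaks (suc i) | a =
    peaks-forces-fDir-shift (λ j → z (suc j)) (p + α) α (β + α)
      (≤-trans 0<β (<⇒≤ β<α)) (subst (α <_) (+-comm α β) (m<m+n α 0<β))
      (λ m → subst₂ _≤_ (sym (+-assoc p α _)) (total-cons z a _ m z0≡) (peaks (suc m))) i

  peaks-forces-fDir-shift : ∀ z p α β → 0 < α → α < β → Peaks z p α β β α →
    ∀ i → z i ≡ fDir (suc i)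
  peaks-forces-fDir-shift z p α β 0<α α<β peaks i with z 0 in z0≡
  ... | a = ⊥-elim (<⇒≱ (+-monoʳ-< p α<β)
    (subst₂ _≤_ (cong (p +_) (+-identityʳ β)) (total-cons z a _ 0 z0≡) (peaks 1)))
  peaks-forces-fDir-shift z p α β 0<α α<β peaks zero    | b = z0≡
  peaks-forces-fDir-shift z p α β 0<α α<β peaks (suc i) | b =
    peaks-forces-fDir (λ j → z (suc j)) (p + β) (α + β) β
      (≤-trans 0<α (<⇒≤ α<β)) (subst (β <_) (+-comm β α) (m<m+n β 0<α))
      (λ m → subst₂ _≤_ (sym (+-assoc p β _)) (total-cons z b _ m z0≡) (peaks (suc m))) i

Optimal : InfWord → Set
Optimal y = ∀ m → peak m 1 0 ≤ total (0 , 0 , 1) (prefix (suc m) y)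

total-a-≤-peak : ∀ u → total (0 , 0 , 1) (a ∷ u) ≤ peak (length u) 1 0
total-a-≤-peak u = total-≤-peak u 0 0 1 1 0 z≤n ≤-refl ≤-refl

-- (ab)^ω and ab²(ab)^ω are optimal; after ab², the counts are (2,2,1) and
-- (ab)^ω again attains the peak.
fDir-optimal : Optimal fDir
fDir-optimal m = ≤-reflexive (sym (total-fDir-shift m 0 0 1 z≤n))

gDir-optimal : Optimal gDir
gDir-optimal zero          = z≤n
gDir-optimal (suc zero)    = ≤-refl
gDir-optimal (suc (suc m)) = ≤-reflexive (sym (total-fDir m 2 2 1 (s≤s z≤n)))

applyUpTo-cong : ∀ {y z : InfWord} → y ≗ z → ∀ n → applyUpTo y n ≡ applyUpTo z n
applyUpTo-cong y≗z zero    = refl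
applyUpTo-cong y≗z (suc n) = cong₂ _∷_ (y≗z 0) (applyUpTo-cong (λ i → y≗z (suc i)) n)

Optimal-resp : ∀ {y z} → y ≗ z → Optimal z → Optimal y
Optimal-resp y≗z opt m = subst (λ w → peak m 1 0 ≤ total (0 , 0 , 1) w) (sym (applyUpTo-cong y≗z (suc m))) (opt m)

PalMaximal : InfWord → Set
PalMaximal y = ∀ (n : ℕ) → 1 ≤ n → ∀ (v : Word) → length v ≡ n → (∃ λ u → v ≡ a ∷ u) →
  countB (ψ v) ≤ countB (ψ (prefix n y))

-- Optimality and maximality coincide, because (ab)^ω is optimal.
optimal⇒maximal : ∀ {y} → Optimal y → PalMaximal y
optimal⇒maximal {y} opt (suc m) _ v |v|≡ (u , refl) = begin
  countB (ψ (a ∷ u))                     ≡⟨ countB-ψ (a ∷ u) ⟩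
  total (0 , 0 , 1) (a ∷ u)              ≤⟨ total-a-≤-peak u ⟩
  peak (length u) 1 0                    ≡⟨ cong (λ n → peak n 1 0) (suc-injective |v|≡) ⟩
  peak m 1 0                             ≤⟨ opt m ⟩
  total (0 , 0 , 1) (prefix (suc m) y)   ≡⟨ sym (countB-ψ (prefix (suc m) y)) ⟩
  countB (ψ (prefix (suc m) y))          ∎
  where open ≤-Reasoning

maximal⇒optimal : ∀ {y} → PalMaximal y → Optimal y
maximal⇒optimal {y} maximal m = begin
  peak m 1 0                                ≤⟨ fDir-optimal m ⟩
  total (0 , 0 , 1) (prefix (suc m) fDir)   ≡⟨ sym (countB-ψ (prefix (suc m) fDir)) ⟩
  countB (ψ (prefix (suc m) fDir))          ≤⟨ maximal (suc m) (s≤s z≤n) (prefix (suc m) fDir)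
                                                 (length-applyUpTo fDir (suc m))
                                                 (applyUpTo (λ i → fDir (suc i)) m , refl) ⟩
  countB (ψ (prefix (suc m) y))             ≡⟨ countB-ψ (prefix (suc m) y) ⟩
  total (0 , 0 , 1) (prefix (suc m) y)      ∎
  where open ≤-Reasoning

-- The optimal directive words starting with a are (ab)^ω and ab²(ab)^ω:
-- the prefix is forced to ab, and after abc the counts are (2,1,2) or
-- (2,2,1), from which the peak forces the rest.
optimal-classification : ∀ {y} → y 0 ≡ a → Optimal y → y ≗ fDir ⊎ y ≗ gDir
optimal-classification {y} y0≡a opt = by-third-letter (y 2) refl
  where
  y1≡b : y 1 ≡ b
  y1≡b with y 1 in y1≡
  ... | b = refl
  ... | a = ⊥-elim (<⇒≱ (s≤s z≤n)
    (subst (λ w → 1 ≤ total (0 , 0 , 1) w) (cong₂ _∷_ y0≡a (cong₂ _∷_ y1≡ (refl {x = []}))) (opt 1)))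
  tail-peaks : ∀ c → y 2 ≡ c → ∀ m →
    2 + peak m 2 1 ≤ total (countStep (1 , 1 , 1) c) (applyUpTo (λ i → y (3 + i)) m)
  tail-peaks c y2≡c m = subst (λ w → 2 + peak m 2 1 ≤ total (0 , 0 , 1) w)
    (cong₂ _∷_ y0≡a (cong₂ _∷_ y1≡b (cong₂ _∷_ y2≡c (refl {x = applyUpTo (λ i → y (3 + i)) m}))))
    (opt (suc (suc m)))
  agree : ∀ d → d 0 ≡ a → d 1 ≡ b → y 2 ≡ d 2 → (∀ i → y (3 + i) ≡ d (3 + i)) → y ≗ d
  agree d d0≡ d1≡ y2≡ rest zero                = trans y0≡a (sym d0≡)
  agree d d0≡ d1≡ y2≡ rest (suc zero)          = trans y1≡b (sym d1≡)
  agree d d0≡ d1≡ y2≡ rest (suc (suc zero))    = y2≡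
  agree d d0≡ d1≡ y2≡ rest (suc (suc (suc i))) = rest i
  by-third-letter : ∀ c → y 2 ≡ c → y ≗ fDir ⊎ y ≗ gDir
  by-third-letter a y2≡a = inj₁ (agree fDir refl refl y2≡a
    (peaks-forces-fDir-shift _ 2 1 2 (s≤s z≤n) (s≤s (s≤s z≤n)) (tail-peaks a y2≡a)))
  by-third-letter b y2≡b = inj₂ (agree gDir refl refl y2≡b
    (peaks-forces-fDir _ 2 2 1 (s≤s z≤n) (s≤s (s≤s z≤n)) (tail-peaks b y2≡b)))

prefix-extends : ∀ (z : InfWord) m n → m ≤ n → ∃ λ s → prefix n z ≡ prefix m z ++ s
prefix-extends z zero    n       _         = prefix n z , refl
prefix-extends z (suc m) (suc n) (s≤s m≤n) with prefix-extends (λ i → z (suc i)) m n m≤n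
... | s , e = s , cong (z 0 ∷_) e

nth-ψ-++-∷ : ∀ p x s → nth (ψ (p ++ x ∷ s)) (length (ψ p)) ≡ x
nth-ψ-++-∷ p x s = begin
  nth (ψ (p ++ x ∷ s)) (length (ψ p))                  ≡⟨ cong₂ nth (ψ-run (p ++ x ∷ s)) (cong length (ψ-run p)) ⟩
  nth (pal (run (p ++ x ∷ s))) (length (pal (run p)))  ≡⟨ cong (λ S → nth (pal S) (length (pal (run p))))
                                                            (foldl-++ advance initial p (x ∷ s)) ⟩
  nth (pal (runFrom (run p) (x ∷ s))) (length (pal (run p)))
                                                       ≡⟨ nth-runFrom (runFrom-coherent initial-coherent p) x s ⟩
  x                                                    ∎
  where open ≡-Reasoning

-- ψ∞ z has the letter z_k at position |ψ(z₁⋯z_k)|: the prefix of order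
-- |ψ(z₁⋯z_k)| + 1 ≥ k + 1 of z continues z₁⋯z_k with z_k.
ψ∞-reads-directive : ∀ z k → ψ∞ z (length (ψ (prefix k z))) ≡ z k
ψ∞-reads-directive z k =
  trans (cong (λ w → nth (ψ w) L) prefix≡) (nth-ψ-++-∷ (prefix k z) (z k) s)
  where
  L = length (ψ (prefix k z))
  k≤L : k ≤ L
  k≤L = subst₂ _≤_ (length-applyUpTo z k) (cong length (sym (ψ-run (prefix k z))))
                   (length-runFrom initial-coherent (prefix k z))
  s : Word
  s = proj₁ (prefix-extends z (suc k) (suc L) (s≤s k≤L))
  prefix≡ : prefix (suc L) z ≡ prefix k z ++ z k ∷ s
  prefix≡ = trans (proj₂ (prefix-extends z (suc k) (suc L) (s≤s k≤L)))
                  (trans (cong (_++ s) (sym (applyUpTo-∷ʳ z k))) (++-assoc (prefix k z) [ z k ] s))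

ψ∞-cong : ∀ y z → y ≗ z → ψ∞ y ≗ ψ∞ z
ψ∞-cong y z y≗z i = cong (λ w → nth (ψ w) i) (applyUpTo-cong y≗z (suc i))

ψ∞-injective : ∀ y z → ψ∞ y ≗ ψ∞ z → y ≗ z
ψ∞-injective y z ψy≗ψz = letters
  where
  mutual
    prefixes : ∀ k → prefix k y ≡ prefix k z
    prefixes zero    = refl
    prefixes (suc k) = trans (sym (applyUpTo-∷ʳ y k))
      (trans (cong₂ (λ p c → p ++ [ c ]) (prefixes k) (letters k)) (applyUpTo-∷ʳ z k))

    letters : ∀ k → y k ≡ z k
    letters k = begin
      y k                                ≡⟨ sym (ψ∞-reads-directive y k) ⟩
      ψ∞ y (length (ψ (prefix k y)))     ≡⟨ ψy≗ψz (length (ψ (prefix k y))) ⟩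
      ψ∞ z (length (ψ (prefix k y)))     ≡⟨ cong (λ p → ψ∞ z (length (ψ p))) (prefixes k) ⟩
      ψ∞ z (length (ψ (prefix k z)))     ≡⟨ ψ∞-reads-directive z k ⟩
      z k                                ∎
      where open ≡-Reasoning

theorem4p9 : (y : InfWord) → BothInfinitelyOften y → y 0 ≡ a →
    ((∀ (n : ℕ) → 1 ≤ n → ∀ (v : Word) → length v ≡ n → (∃ λ u → v ≡ a ∷ u) →
        countB (ψ v) ≤ countB (ψ (prefix n y)))
     ⇔ (ψ∞ y ≗ f ⊎ ψ∞ y ≗ g))
theorem4p9 y _ y0≡a = mk⇔ to from
  where
  to : PalMaximal y → ψ∞ y ≗ f ⊎ ψ∞ y ≗ g
  to = Sum.map (ψ∞-cong y fDir) (ψ∞-cong y gDir) ∘ optimal-classification y0≡a ∘ maximal⇒optimal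
  from : ψ∞ y ≗ f ⊎ ψ∞ y ≗ g → PalMaximal y
  from (inj₁ ψy≗f) = optimal⇒maximal (Optimal-resp (ψ∞-injective y fDir ψy≗f) fDir-optimal)
  from (inj₂ ψy≗g) = optimal⇒maximal (Optimal-resp (ψ∞-injective y gDir ψy≗g) gDir-optimal)
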